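{- Let $n \geq 5$ and let $\overrightarrow{S_n}$ be the oriented star graph defined in the context. Then the (directed) diameter of $\overrightarrow{S_n}$ is at least $2n-1$. Further, if $n \neq 6$, the diameter of $\overrightarrow{S_n}$ is at least $2n$.
   Context: For $n \ge 2$, the $n$-star graph $S_n$ has as vertices the $n!$ permutations of $[n]=\{1,\dots,n\}$ (a permutation $\pi$ is viewed as the sequence $\pi(1)\pi(2)\cdots\pi(n)$ of values in positions $1,\dots,n$); two permutations are adjacent iff one is obtained from the other by exchanging the values in position $1$ and position $i$ for some $i\in\{2,\dots,n\}$. The sign of a permutation is the parity of its number of inversions (pairs $x<y$ with $\pi(x)>\pi(y)$); adjacent permutations have opposite signs. Let $k=\lceil (n-1)/2\rceil+1$. The oriented star graph $\overrightarrow{S_n}$ (Fujita's orientation) orients each edge $\{\pi,\pi'\}$, where $\pi$ is even and $\pi'$ is obtained from $\pi$ by exchanging positions $1$ and $i$, as the arc $\pi\to\pi'$ if $i\in\{2,\dots,k\}$ and as the arc $\pi'\to\pi$ if $i\in\{k+1,\dots,n\}$. Equivalently, from an even permutation one may move by swapping position $1$ with a position in $\{2,\dots,k\}$, and from an odd permutation by swapping position $1$ with a position in $\{k+1,\dots,n\}$. The diameter of a directed graph is the maximum over ordered pairs $(u,v)$ of the length of a shortest directed path from $u$ to $v$. -}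

module Defs where

open import Data.Nat.Base using (ℕ; zero; suc; _+_; _∸_; _≤_; _%_; ⌈_/2⌉; _<ᵇ_)
open import Data.Fin.Base using (Fin; toℕ)
open import Data.Fin.Permutation using (Permutation′; _⟨$⟩ʳ_)
import Data.Fin.Permutation.Components as PC
open import Data.List.Base using (List; map; allFin)
open import Data.Nat.ListAction using (sum)
open import Data.Bool.Base using (Bool; true; false; if_then_else_; _∧_)
open import Data.Product.Base using (Σ; _×_)
open import Data.Sum.Base using (_⊎_)
open import Relation.Binary.PropositionalEquality using (_≡_)

-- Vertices of S_n: permutations of Fin n.  π ⟨$⟩ʳ x is the value at
-- (0-based) position x; 0-based position p corresponds to position p+1.

ind : Bool → ℕ
ind true  = 1
ind false = 0

inversions : (n : ℕ) → Permutation′ n → ℕ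
inversions n π =
  sum (map (λ x → sum (map (λ y →
        ind ((toℕ x <ᵇ toℕ y) ∧ (toℕ (π ⟨$⟩ʳ y) <ᵇ toℕ (π ⟨$⟩ʳ x))))
      (allFin n))) (allFin n))

Even : (n : ℕ) → Permutation′ n → Set
Even n π = inversions n π % 2 ≡ 0

Odd : (n : ℕ) → Permutation′ n → Set
Odd n π = inversions n π % 2 ≡ 1

kOf : ℕ → ℕ
kOf n = ⌈ n ∸ 1 /2⌉ + 1

-- Arc of Fujita's oriented star graph: π' is obtained from π by exchanging
-- the values in position 1 (0-based index i with toℕ i = 0) and position
-- toℕ j + 1, where toℕ j + 1 ∈ {2,…,k} if π is even, and ∈ {k+1,…,n} if π is odd.
Arc : (n : ℕ) → Permutation′ n → Permutation′ n → Set
Arc n π π' =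
  Σ (Fin n) λ i → Σ (Fin n) λ j →
    (toℕ i ≡ 0) ×
    (((Even n π × (2 ≤ toℕ j + 1) × (toℕ j + 1 ≤ kOf n))
      ⊎ (Odd n π × (kOf n + 1 ≤ toℕ j + 1) × (toℕ j + 1 ≤ n)))) ×
    ((x : Fin n) → π' ⟨$⟩ʳ x ≡ π ⟨$⟩ʳ (PC.transpose i j x))

data Walk (n : ℕ) : Permutation′ n → Permutation′ n → ℕ → Set where
  stop : ∀ {π ρ} → ((x : Fin n) → π ⟨$⟩ʳ x ≡ ρ ⟨$⟩ʳ x) → Walk n π ρ 0
  step : ∀ {π σ ρ m} → Arc n π σ → Walk n σ ρ m → Walk n π ρ (suc m)

module Submission where

-- Write n = N + 1, k = kOf n; a position p ∈ {1,…,N} (0-based) is small if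
-- p < k and large otherwise: even vertices exchange position 0 with small
-- positions, odd vertices with large ones.  All walks end at the identity.
--  1. Parity: an arc is a transposition (a conjugate of adjacent swaps), so
--     it flips the parity of the inversion count; a walk between two even
--     permutations has even length.
--  2. Potential: a weighted count Φ of misplaced values drops by at most 1
--     along an arc, and not at all when position 0 holds 0; so a walk from
--     u to id has length ≥ Φ(u), and ≥ Φ(u) + 1 if u fixes 0.
--  3. Witnesses: if u fixes 0 and moves every other position to another
--     position of its class, Φ(u) = 2N, so walks from u have length
--     ≥ 2n - 1, and ≥ 2n if u is even.  Such u are products of rotations of
--     one-class blocks; the parity count of the cycles gives an even u for
--     odd n and (splitting the small block as 2 + rest) for even n ≥ 8.

open import Defs
open import Data.Nat.Base
open import Data.Nat.Properties
open import Data.Bool.Base using (Bool; true; false; if_then_else_; _∧_; not; T)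
open import Data.Bool.Properties using (not-involutive; ∧-zeroʳ)
open import Data.Fin.Base using (Fin; zero; suc; toℕ; inject₁)
open import Data.Fin.Properties using (toℕ-injective; toℕ-inject₁; toℕ<n)
  renaming (_≟_ to _≟ᶠ_)
open import Data.Fin.Permutation as Perm
  using (Permutation′; _⟨$⟩ʳ_; _⟨$⟩ˡ_; _∘ₚ_; inverseˡ)
import Data.Fin.Permutation.Components as PC
open import Data.List.Base using (map; allFin; tabulate)
open import Data.List.Properties using (map-tabulate; map-cong)
import Data.Nat.ListAction as List
open import Algebra.Properties.CommutativeMonoid.Sum +-0-commutativeMonoid
  using (sum; sum-cong-≗; ∑-distrib-+; ∑-permute)
open import Data.Product.Base using (Σ; _×_; _,_; proj₁; proj₂)
open import Data.Sum.Base using (_⊎_; inj₁; inj₂)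
open import Data.Empty using (⊥; ⊥-elim)
open import Relation.Nullary using (¬_; yes; no)
open import Relation.Nullary.Decidable using (dec-true; dec-false)
open import Relation.Binary.PropositionalEquality
open import Function.Definitions using (Injective)

sum-allFin : ∀ {n} (f : Fin n → ℕ) → List.sum (map f (allFin n)) ≡ sum f
sum-allFin f = trans (cong List.sum (map-tabulate (λ x → x) f)) (sum-tabulate f)
  where
  sum-tabulate : ∀ {n} (f : Fin n → ℕ) → List.sum (tabulate f) ≡ sum f
  sum-tabulate {zero} f = refl
  sum-tabulate {suc n} f = cong (f zero +_) (sum-tabulate (λ x → f (suc x)))

sum-mono : ∀ {n} {f g : Fin n → ℕ} → (∀ x → f x ≤ g x) → sum f ≤ sum g
sum-mono {zero} f≤g = z≤n
sum-mono {suc n} f≤g = +-mono-≤ (f≤g zero) (sum-mono (λ x → f≤g (suc x)))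

sum-zero : ∀ {n} (f : Fin n → ℕ) → (∀ x → f x ≡ 0) → sum f ≡ 0
sum-zero {zero} f f≡0 = refl
sum-zero {suc n} f f≡0 rewrite f≡0 zero = sum-zero (λ x → f (suc x)) (λ x → f≡0 (suc x))

sum-const : ∀ {n} c → sum {n} (λ _ → c) ≡ n * c
sum-const {zero} c = refl
sum-const {suc n} c = cong (c +_) (sum-const {n} c)

sum-single : ∀ {n} (t : ℕ) (d : Fin n) → toℕ d ≡ t → (r : Fin n → ℕ) →
  sum (λ y → if toℕ y ≡ᵇ t then r y else 0) ≡ r d
sum-single {suc n} t zero refl r =
  trans (cong (r zero +_) (sum-zero {n} _ (λ _ → refl))) (+-identityʳ _)
sum-single (suc t) (suc d) refl r = sum-single t d refl (λ y → r (suc y))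

ind∧ : ∀ b r → ind (b ∧ r) ≡ (if b then ind r else 0)
ind∧ true r = refl
ind∧ false r = refl

≡ᵇ-refl : ∀ a → (a ≡ᵇ a) ≡ true
≡ᵇ-refl zero = refl
≡ᵇ-refl (suc a) = ≡ᵇ-refl a

≡ᵇ-true : ∀ a b → (a ≡ᵇ b) ≡ true → a ≡ b
≡ᵇ-true a b e = ≡ᵇ⇒≡ a b (subst T (sym e) _)

<ᵇ-true : ∀ {a b} → a < b → (a <ᵇ b) ≡ true
<ᵇ-true {a} {b} a<b with a <ᵇ b | <⇒<ᵇ a<b
... | true | _ = refl

<ᵇ-false : ∀ {a b} → b ≤ a → (a <ᵇ b) ≡ false
<ᵇ-false {a} {b} b≤a with a <ᵇ b in eq
... | true = ⊥-elim (<⇒≱ (<ᵇ⇒< a b (subst T (sym eq) _)) b≤a)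
... | false = refl

<ᵇ-trichotomy : ∀ a b → a ≢ b → ind (a <ᵇ b) + ind (b <ᵇ a) ≡ 1
<ᵇ-trichotomy zero zero a≢b = ⊥-elim (a≢b refl)
<ᵇ-trichotomy zero (suc b) a≢b = refl
<ᵇ-trichotomy (suc a) zero a≢b = refl
<ᵇ-trichotomy (suc a) (suc b) a≢b = <ᵇ-trichotomy a b (λ e → a≢b (cong suc e))

flips : ℕ → Bool → Bool
flips zero b = b
flips (suc m) b = not (flips m b)

isEven : ℕ → Bool
isEven m = flips m true

isEven-suc : ∀ m → isEven (m + 1) ≡ not (isEven m)
isEven-suc m rewrite +-comm m 1 = refl

flips-not : ∀ m b → flips m (not b) ≡ not (flips m b)
flips-not zero b = refl
flips-not (suc m) b = cong not (flips-not m b)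

flips-+ : ∀ l m b → flips (l + m) b ≡ flips l (flips m b)
flips-+ zero m b = refl
flips-+ (suc l) m b = cong not (flips-+ l m b)

flips-cancel : ∀ m b → flips m (flips m b) ≡ b
flips-cancel zero b = refl
flips-cancel (suc m) b =
  trans (cong not (flips-not m (flips m b))) (trans (not-involutive _) (flips-cancel m b))

flips-double : ∀ m b → flips (m + m) b ≡ b
flips-double m b = trans (flips-+ m m b) (flips-cancel m b)

-- Equality on Fin, decided through toℕ so that case splits on it do not
-- interfere with the decisions inside PC.transpose.
fin-dec : ∀ {n} (x y : Fin n) → (x ≡ y) ⊎ (x ≢ y)
fin-dec x y with toℕ x ≟ toℕ y
... | yes e = inj₁ (toℕ-injective e)
... | no ne = inj₂ (λ e → ne (cong toℕ e))

transpose-left : ∀ {n} (i j : Fin n) → PC.transpose i j i ≡ j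
transpose-left i j rewrite dec-true (i ≟ᶠ i) refl = refl

transpose-right : ∀ {n} (i j : Fin n) → PC.transpose i j j ≡ i
transpose-right i j with fin-dec j i
... | inj₁ j≡i rewrite dec-true (j ≟ᶠ i) j≡i = j≡i
... | inj₂ j≢i rewrite dec-false (j ≟ᶠ i) j≢i | dec-true (j ≟ᶠ j) refl = refl

transpose-other : ∀ {n} (i j k : Fin n) → k ≢ i → k ≢ j → PC.transpose i j k ≡ k
transpose-other i j k k≢i k≢j rewrite dec-false (k ≟ᶠ i) k≢i | dec-false (k ≟ᶠ j) k≢j = refl

transpose-involutive : ∀ {n} (i j k : Fin n) → PC.transpose i j (PC.transpose i j k) ≡ k
transpose-involutive i j k with fin-dec k i | fin-dec k j
... | inj₁ refl | _ = trans (cong (PC.transpose k j) (transpose-left k j)) (transpose-right k j)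
... | inj₂ _ | inj₁ refl = trans (cong (PC.transpose i k) (transpose-right i k)) (transpose-left i k)
... | inj₂ k≢i | inj₂ k≢j =
  trans (cong (PC.transpose i j) (transpose-other i j k k≢i k≢j)) (transpose-other i j k k≢i k≢j)

transpose-injective : ∀ {n} (i j : Fin n) {x y} → PC.transpose i j x ≡ PC.transpose i j y → x ≡ y
transpose-injective i j {x} {y} e =
  trans (sym (transpose-involutive i j x)) (trans (cong (PC.transpose i j) e) (transpose-involutive i j y))

transpose-conjugate : ∀ {n} (i j' j x : Fin n) → i ≢ j' → i ≢ j → j' ≢ j →
  PC.transpose i j x ≡ PC.transpose j' j (PC.transpose i j' (PC.transpose j' j x))
transpose-conjugate i j' j x i≢j' i≢j j'≢j with fin-dec x i | fin-dec x j | fin-dec x j'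
... | inj₁ refl | _ | _ = sym (begin
    PC.transpose j' j (PC.transpose x j' (PC.transpose j' j x))
  ≡⟨ cong (λ z → PC.transpose j' j (PC.transpose x j' z)) (transpose-other j' j x i≢j' i≢j) ⟩
    PC.transpose j' j (PC.transpose x j' x)
  ≡⟨ cong (PC.transpose j' j) (transpose-left x j') ⟩
    PC.transpose j' j j'
  ≡⟨ transpose-left j' j ⟩
    j
  ≡⟨ sym (transpose-left x j) ⟩
    PC.transpose x j x
  ∎)
  where open ≡-Reasoning
... | inj₂ _ | inj₁ refl | _ = sym (begin
    PC.transpose j' x (PC.transpose i j' (PC.transpose j' x x))
  ≡⟨ cong (λ z → PC.transpose j' x (PC.transpose i j' z)) (transpose-right j' x) ⟩
    PC.transpose j' x (PC.transpose i j' j')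
  ≡⟨ cong (PC.transpose j' x) (transpose-right i j') ⟩
    PC.transpose j' x i
  ≡⟨ transpose-other j' x i i≢j' i≢j ⟩
    i
  ≡⟨ sym (transpose-right i x) ⟩
    PC.transpose i x x
  ∎)
  where open ≡-Reasoning
... | inj₂ x≢i | inj₂ x≢j | inj₁ refl = sym (begin
    PC.transpose x j (PC.transpose i x (PC.transpose x j x))
  ≡⟨ cong (λ z → PC.transpose x j (PC.transpose i x z)) (transpose-left x j) ⟩
    PC.transpose x j (PC.transpose i x j)
  ≡⟨ cong (PC.transpose x j) (transpose-other i x j (λ e → i≢j (sym e)) (λ e → j'≢j (sym e))) ⟩
    PC.transpose x j j
  ≡⟨ transpose-right x j ⟩
    x
  ≡⟨ sym (transpose-other i j x x≢i x≢j) ⟩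
    PC.transpose i j x
  ∎)
  where open ≡-Reasoning
... | inj₂ x≢i | inj₂ x≢j | inj₂ x≢j' = begin
    PC.transpose i j x
  ≡⟨ transpose-other i j x x≢i x≢j ⟩
    x
  ≡⟨ sym (transpose-other j' j x x≢j' x≢j) ⟩
    PC.transpose j' j x
  ≡⟨ cong (PC.transpose j' j) (sym (transpose-other i j' x x≢i x≢j')) ⟩
    PC.transpose j' j (PC.transpose i j' x)
  ≡⟨ cong (λ z → PC.transpose j' j (PC.transpose i j' z)) (sym (transpose-other j' j x x≢j' x≢j)) ⟩
    PC.transpose j' j (PC.transpose i j' (PC.transpose j' j x))
  ∎
  where open ≡-Reasoning

inv : ∀ {n} → (Fin n → ℕ) → ℕ
inv g = sum λ x → sum λ y → ind ((toℕ x <ᵇ toℕ y) ∧ (g y <ᵇ g x))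

inversions≡inv : ∀ n (π : Permutation′ n) → inversions n π ≡ inv (λ x → toℕ (π ⟨$⟩ʳ x))
inversions≡inv n π =
  trans (cong List.sum (map-cong (λ x → sum-allFin (row x)) (allFin n))) (sum-allFin (λ x → sum (row x)))
  where
  row : Fin n → Fin n → ℕ
  row x y = ind ((toℕ x <ᵇ toℕ y) ∧ (toℕ (π ⟨$⟩ʳ y) <ᵇ toℕ (π ⟨$⟩ʳ x)))

inv-cong : ∀ {n} {g g' : Fin n → ℕ} → (∀ x → g x ≡ g' x) → inv g ≡ inv g'
inv-cong g≗g' = sum-cong-≗ λ x → sum-cong-≗ λ y →
  cong₂ (λ a b → ind ((toℕ x <ᵇ toℕ y) ∧ (a <ᵇ b))) (g≗g' y) (g≗g' x)

inv-transpose : ∀ {n} (g : Fin n → ℕ) (i j : Fin n) → let τ = PC.transpose i j in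
  inv (λ x → g (τ x)) ≡ sum λ x → sum λ y → ind ((toℕ (τ x) <ᵇ toℕ (τ y)) ∧ (g y <ᵇ g x))
inv-transpose g i j =
  trans (∑-permute _ (Perm.transpose i j)) (sum-cong-≗ λ x →
    trans (∑-permute _ (Perm.transpose i j)) (sum-cong-≗ λ y →
      cong₂ (λ a b → ind ((toℕ (τ x) <ᵇ toℕ (τ y)) ∧ (g a <ᵇ g b)))
        (transpose-involutive i j y) (transpose-involutive i j x)))
  where τ = PC.transpose i j

swapNext : ℕ → ℕ → ℕ
swapNext zero zero = 1
swapNext zero (suc zero) = 0
swapNext zero (suc (suc a)) = suc (suc a)
swapNext (suc c) zero = zero
swapNext (suc c) (suc a) = suc (swapNext c a)

-- Pointwise form of "an adjacent swap changes the inversion set exactly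
-- in the pair {c, c+1}": a finite case check.
swapNext-pair : ∀ c a b (q : Bool) →
  ind ((swapNext c a <ᵇ swapNext c b) ∧ q) + ind ((a ≡ᵇ c) ∧ ((b ≡ᵇ suc c) ∧ q))
  ≡ ind ((a <ᵇ b) ∧ q) + ind ((a ≡ᵇ suc c) ∧ ((b ≡ᵇ c) ∧ q))
swapNext-pair zero zero zero q = refl
swapNext-pair zero zero (suc zero) false = refl
swapNext-pair zero zero (suc zero) true = refl
swapNext-pair zero zero (suc (suc b)) false = refl
swapNext-pair zero zero (suc (suc b)) true = refl
swapNext-pair zero (suc zero) zero false = refl
swapNext-pair zero (suc zero) zero true = refl
swapNext-pair zero (suc zero) (suc zero) q = refl
swapNext-pair zero (suc zero) (suc (suc b)) false = refl
swapNext-pair zero (suc zero) (suc (suc b)) true = refl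
swapNext-pair zero (suc (suc a)) zero false = refl
swapNext-pair zero (suc (suc a)) zero true = refl
swapNext-pair zero (suc (suc a)) (suc zero) false = refl
swapNext-pair zero (suc (suc a)) (suc zero) true = refl
swapNext-pair zero (suc (suc a)) (suc (suc b)) q = refl
swapNext-pair (suc c) zero zero q = refl
swapNext-pair (suc c) zero (suc b) false = refl
swapNext-pair (suc c) zero (suc b) true = refl
swapNext-pair (suc c) (suc a) zero q rewrite ∧-zeroʳ (a ≡ᵇ c) | ∧-zeroʳ (a ≡ᵇ suc c) = refl
swapNext-pair (suc c) (suc a) (suc b) q = swapNext-pair c a b q

swapNext-left : ∀ c → swapNext c c ≡ suc c
swapNext-left zero = refl
swapNext-left (suc c) = cong suc (swapNext-left c)

swapNext-right : ∀ c → swapNext c (suc c) ≡ c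
swapNext-right zero = refl
swapNext-right (suc c) = cong suc (swapNext-right c)

swapNext-other : ∀ c a → a ≢ c → a ≢ suc c → swapNext c a ≡ a
swapNext-other zero zero a≢c _ = ⊥-elim (a≢c refl)
swapNext-other zero (suc zero) _ a≢1+c = ⊥-elim (a≢1+c refl)
swapNext-other zero (suc (suc a)) _ _ = refl
swapNext-other (suc c) zero _ _ = refl
swapNext-other (suc c) (suc a) a≢c a≢1+c =
  cong suc (swapNext-other c a (λ e → a≢c (cong suc e)) (λ e → a≢1+c (cong suc e)))

toℕ-transpose-adjacent : ∀ {n} (c d x : Fin n) → toℕ d ≡ suc (toℕ c) →
  toℕ (PC.transpose c d x) ≡ swapNext (toℕ c) (toℕ x)
toℕ-transpose-adjacent c d x d≡c+1 with fin-dec x c | fin-dec x d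
... | inj₁ refl | _ =
  trans (cong toℕ (transpose-left x d)) (trans d≡c+1 (sym (swapNext-left (toℕ x))))
... | inj₂ _ | inj₁ refl =
  trans (cong toℕ (transpose-right c x)) (sym (trans (cong (swapNext (toℕ c)) d≡c+1) (swapNext-right (toℕ c))))
... | inj₂ x≢c | inj₂ x≢d = trans (cong toℕ (transpose-other c d x x≢c x≢d))
  (sym (swapNext-other (toℕ c) (toℕ x) (λ e → x≢c (toℕ-injective e))
                                       (λ e → x≢d (toℕ-injective (trans e (sym d≡c+1))))))

sum-single-ind : ∀ {n} (t : ℕ) (d : Fin n) → toℕ d ≡ t → (P : Fin n → Bool) →
  sum (λ y → ind ((toℕ y ≡ᵇ t) ∧ P y)) ≡ ind (P d)
sum-single-ind t d d≡t P =
  trans (sum-cong-≗ (λ y → ind∧ (toℕ y ≡ᵇ t) (P y))) (sum-single t d d≡t (λ y → ind (P y)))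

sum-pair : ∀ {n} (tx ty : ℕ) (c d : Fin n) → toℕ c ≡ tx → toℕ d ≡ ty → (Q : Fin n → Fin n → Bool) →
  sum (λ x → sum (λ y → ind ((toℕ x ≡ᵇ tx) ∧ ((toℕ y ≡ᵇ ty) ∧ Q x y)))) ≡ ind (Q c d)
sum-pair {n} tx ty c d c≡tx d≡ty Q =
  trans (sum-cong-≗ row) (trans (sum-single tx c c≡tx _) (sum-single-ind ty d d≡ty (Q c)))
  where
  row : ∀ x → sum (λ y → ind ((toℕ x ≡ᵇ tx) ∧ ((toℕ y ≡ᵇ ty) ∧ Q x y)))
            ≡ (if toℕ x ≡ᵇ tx then sum (λ y → ind ((toℕ y ≡ᵇ ty) ∧ Q x y)) else 0)
  row x with toℕ x ≡ᵇ tx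
  ... | true = refl
  ... | false = sum-zero {n} _ (λ _ → refl)

inv-adjacent : ∀ {n} (g : Fin n → ℕ) (c d : Fin n) → toℕ d ≡ suc (toℕ c) →
  inv (λ x → g (PC.transpose c d x)) + ind (g d <ᵇ g c) ≡ inv g + ind (g c <ᵇ g d)
inv-adjacent {n} g c d d≡c+1 = begin
    inv (λ x → g (τ x)) + ind (g d <ᵇ g c)
  ≡⟨ cong₂ _+_ (inv-transpose g c d) (sym (sum-pair (toℕ c) (suc (toℕ c)) c d refl d≡c+1 Q)) ⟩
    sum (λ x → sum (λ y → swapped x y)) + sum (λ x → sum (λ y → at-c-d x y))
  ≡⟨ sym (∑-distrib-+ (λ x → sum (λ y → swapped x y)) (λ x → sum (λ y → at-c-d x y))) ⟩
    sum (λ x → sum (λ y → swapped x y) + sum (λ y → at-c-d x y))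
  ≡⟨ sum-cong-≗ (λ x → sym (∑-distrib-+ (swapped x) (at-c-d x))) ⟩
    sum (λ x → sum (λ y → swapped x y + at-c-d x y))
  ≡⟨ sum-cong-≗ (λ x → sum-cong-≗ (λ y → pointwise x y)) ⟩
    sum (λ x → sum (λ y → plain x y + at-d-c x y))
  ≡⟨ sum-cong-≗ (λ x → ∑-distrib-+ (plain x) (at-d-c x)) ⟩
    sum (λ x → sum (λ y → plain x y) + sum (λ y → at-d-c x y))
  ≡⟨ ∑-distrib-+ (λ x → sum (λ y → plain x y)) (λ x → sum (λ y → at-d-c x y)) ⟩
    inv g + sum (λ x → sum (λ y → at-d-c x y))
  ≡⟨ cong (inv g +_) (sum-pair (suc (toℕ c)) (toℕ c) d c d≡c+1 refl Q) ⟩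
    inv g + ind (g c <ᵇ g d)
  ∎
  where
  open ≡-Reasoning
  τ : Fin n → Fin n
  τ = PC.transpose c d
  Q : Fin n → Fin n → Bool
  Q x y = g y <ᵇ g x
  swapped plain at-c-d at-d-c : Fin n → Fin n → ℕ
  swapped x y = ind ((toℕ (τ x) <ᵇ toℕ (τ y)) ∧ Q x y)
  plain x y = ind ((toℕ x <ᵇ toℕ y) ∧ Q x y)
  at-c-d x y = ind ((toℕ x ≡ᵇ toℕ c) ∧ ((toℕ y ≡ᵇ suc (toℕ c)) ∧ Q x y))
  at-d-c x y = ind ((toℕ x ≡ᵇ suc (toℕ c)) ∧ ((toℕ y ≡ᵇ toℕ c) ∧ Q x y))
  pointwise : ∀ x y → swapped x y + at-c-d x y ≡ plain x y + at-d-c x y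
  pointwise x y rewrite toℕ-transpose-adjacent c d x d≡c+1 | toℕ-transpose-adjacent c d y d≡c+1 =
    swapNext-pair (toℕ c) (toℕ x) (toℕ y) (Q x y)

inv-adjacent-flip : ∀ {n} (g : Fin n → ℕ) (c d : Fin n) → toℕ d ≡ suc (toℕ c) → g c ≢ g d →
  isEven (inv (λ x → g (PC.transpose c d x))) ≡ not (isEven (inv g))
inv-adjacent-flip g c d d≡c+1 gc≢gd =
  parity-shift _ _ (g d <ᵇ g c) (g c <ᵇ g d) (inv-adjacent g c d d≡c+1)
    (<ᵇ-trichotomy (g d) (g c) (λ e → gc≢gd (sym e)))
  where
  parity-shift : ∀ A B (p q : Bool) → A + ind p ≡ B + ind q → ind p + ind q ≡ 1 →
    isEven A ≡ not (isEven B)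
  parity-shift A B false true e _ = trans (cong isEven (trans (sym (+-identityʳ A)) e)) (isEven-suc B)
  parity-shift A B true false e _ = trans (sym (not-involutive (isEven A)))
    (cong not (trans (sym (isEven-suc A)) (cong isEven (trans e (+-identityʳ B)))))

-- Exchanging positions 0 and t+1 of an injective sequence flips the parity
-- of its inversion count: induction on t, writing (0 t+1) = (t t+1)(0 t)(t t+1).
inv-star-flip : ∀ {n} (t : ℕ) (g : Fin n → ℕ) → Injective _≡_ _≡_ g → (i j : Fin n) →
  toℕ i ≡ 0 → toℕ j ≡ suc t →
  isEven (inv (λ x → g (PC.transpose i j x))) ≡ not (isEven (inv g))
inv-star-flip zero g g-inj i j i≡0 j≡1 =
  inv-adjacent-flip g i j (trans j≡1 (cong suc (sym i≡0)))
    (λ e → 0≢1+n (trans (sym i≡0) (trans (cong toℕ (g-inj e)) j≡1)))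
inv-star-flip {suc m} (suc t) g g-inj i (suc j₀) i≡0 j≡t+2 = begin
    isEven (inv (λ x → g (PC.transpose i j x)))
  ≡⟨ cong isEven (inv-cong (λ x → cong g (transpose-conjugate i j' j x i≢j' i≢j j'≢j))) ⟩
    isEven (inv (λ x → gs (PC.transpose i j' (s x))))
  ≡⟨ inv-adjacent-flip (λ x → gs (PC.transpose i j' x)) j' j j≡j'+1 (λ e → j'≢j (gsτ-inj e)) ⟩
    not (isEven (inv (λ x → gs (PC.transpose i j' x))))
  ≡⟨ cong not (inv-star-flip t gs gs-inj i j' i≡0 j'≡t+1) ⟩
    not (not (isEven (inv gs)))
  ≡⟨ not-involutive _ ⟩
    isEven (inv gs)
  ≡⟨ inv-adjacent-flip g j' j j≡j'+1 (λ e → j'≢j (g-inj e)) ⟩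
    not (isEven (inv g))
  ∎
  where
  open ≡-Reasoning
  j : Fin (suc m)
  j = suc j₀
  j' : Fin (suc m)
  j' = inject₁ j₀
  j'≡t+1 : toℕ j' ≡ suc t
  j'≡t+1 = trans (toℕ-inject₁ j₀) (suc-injective j≡t+2)
  j≡j'+1 : toℕ j ≡ suc (toℕ j')
  j≡j'+1 = cong suc (sym (toℕ-inject₁ j₀))
  s : Fin (suc m) → Fin (suc m)
  s = PC.transpose j' j
  gs : Fin (suc m) → ℕ
  gs x = g (s x)
  gs-inj : Injective _≡_ _≡_ gs
  gs-inj e = transpose-injective j' j (g-inj e)
  gsτ-inj : Injective _≡_ _≡_ (λ x → gs (PC.transpose i j' x))
  gsτ-inj e = transpose-injective i j' (gs-inj e)
  i≢j' : i ≢ j'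
  i≢j' e = 0≢1+n (trans (sym i≡0) (trans (cong toℕ e) j'≡t+1))
  i≢j : i ≢ j
  i≢j e = 0≢1+n (trans (sym i≡0) (trans (cong toℕ e) j≡t+2))
  j'≢j : j' ≢ j
  j'≢j e = 1+n≢n (sym (trans (cong toℕ e) j≡j'+1))

values : ∀ {n} → Permutation′ n → Fin n → ℕ
values π x = toℕ (π ⟨$⟩ʳ x)

perm-injective : ∀ {n} (π : Permutation′ n) → Injective _≡_ _≡_ (π ⟨$⟩ʳ_)
perm-injective π e = trans (sym (inverseˡ π)) (trans (cong (π ⟨$⟩ˡ_) e) (inverseˡ π))

values-injective : ∀ {n} (π : Permutation′ n) → Injective _≡_ _≡_ (values π)
values-injective π e = perm-injective π (toℕ-injective e)

evenPerm : ∀ n → Permutation′ n → Bool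
evenPerm n π = isEven (inversions n π)

parity≡ : ∀ n (π : Permutation′ n) → evenPerm n π ≡ isEven (inv (values π))
parity≡ n π = cong isEven (inversions≡inv n π)

parity-ext : ∀ n (π ρ : Permutation′ n) → (∀ x → π ⟨$⟩ʳ x ≡ ρ ⟨$⟩ʳ x) →
  evenPerm n π ≡ evenPerm n ρ
parity-ext n π ρ π≗ρ =
  trans (parity≡ n π) (trans (cong isEven (inv-cong (λ x → cong toℕ (π≗ρ x)))) (sym (parity≡ n ρ)))

isEven-even : ∀ m → m % 2 ≡ 0 → isEven m ≡ true
isEven-even zero _ = refl
isEven-even (suc (suc m)) e = trans (not-involutive _) (isEven-even m e)

isEven-odd : ∀ m → m % 2 ≡ 1 → isEven m ≡ false
isEven-odd (suc zero) _ = refl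
isEven-odd (suc (suc m)) e = trans (not-involutive _) (isEven-odd m e)

-- The exchange performed by an arc: positions 0 and t+1 are swapped, and
-- t+1 is small (t+1 < k) exactly when π is even.
record Exchange n (π σ : Permutation′ n) : Set where
  field
    t : ℕ
    i j : Fin n
    i≡0 : toℕ i ≡ 0
    j≡t+1 : toℕ j ≡ suc t
    σ≗πτ : ∀ x → σ ⟨$⟩ʳ x ≡ π ⟨$⟩ʳ (PC.transpose i j x)
    class : (suc t <ᵇ kOf n) ≡ evenPerm n π

arc-exchange : ∀ n π σ → Arc n π σ → Exchange n π σ
arc-exchange n π σ (i , j , i≡0 , inj₁ (even , 2≤j+1 , j+1≤k) , σ≗πτ) =
  positive (toℕ j) refl 2≤j+1 j+1≤k
  where
  positive : ∀ a → toℕ j ≡ a → 2 ≤ a + 1 → a + 1 ≤ kOf n → Exchange n π σ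
  positive zero _ (s≤s ()) _
  positive (suc t) j≡t+1 _ t+2≤k = record
    { t = t ; i = i ; j = j ; i≡0 = i≡0 ; j≡t+1 = j≡t+1 ; σ≗πτ = σ≗πτ
    ; class = trans (<ᵇ-true (subst (_≤ kOf n) (+-comm (suc t) 1) t+2≤k))
                    (sym (isEven-even (inversions n π) even)) }
arc-exchange n π σ (i , j , i≡0 , inj₂ (odd , k+1≤j+1 , _) , σ≗πτ) = positive (toℕ j) refl k≤j
  where
  k≤j : kOf n ≤ toℕ j
  k≤j = +-cancelʳ-≤ 1 (kOf n) (toℕ j) k+1≤j+1
  positive : ∀ a → toℕ j ≡ a → kOf n ≤ a → Exchange n π σ
  positive zero _ k≤0 = ⊥-elim (<⇒≱ (m≤n+m 1 ⌈ n ∸ 1 /2⌉) k≤0)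
  positive (suc t) j≡t+1 k≤t+1 = record
    { t = t ; i = i ; j = j ; i≡0 = i≡0 ; j≡t+1 = j≡t+1 ; σ≗πτ = σ≗πτ
    ; class = trans (<ᵇ-false k≤t+1) (sym (isEven-odd (inversions n π) odd)) }

parity-arc : ∀ n π σ → Arc n π σ → evenPerm n σ ≡ not (evenPerm n π)
parity-arc n π σ a = begin
    evenPerm n σ
  ≡⟨ parity≡ n σ ⟩
    isEven (inv (values σ))
  ≡⟨ cong isEven (inv-cong (λ x → cong toℕ (σ≗πτ x))) ⟩
    isEven (inv (λ x → values π (PC.transpose i j x)))
  ≡⟨ inv-star-flip t (values π) (values-injective π) i j i≡0 j≡t+1 ⟩
    not (isEven (inv (values π)))
  ≡⟨ cong not (sym (parity≡ n π)) ⟩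
    not (evenPerm n π)
  ∎
  where
  open ≡-Reasoning
  open Exchange (arc-exchange n π σ a)

parity-walk : ∀ {n π ρ m} → Walk n π ρ m → evenPerm n π ≡ flips m (evenPerm n ρ)
parity-walk {n} {π} {ρ} (stop π≗ρ) = parity-ext n π ρ π≗ρ
parity-walk {n} {π} (step {σ = σ} a w) =
  trans (sym (not-involutive _)) (cong not (trans (sym (parity-arc n π σ a)) (parity-walk w)))

-- agree S X: the class S of a position is the one that the parity X
-- allows to exchange with position 0.
agree : Bool → Bool → Bool
agree true X = X
agree false X = not X

agree-refl : ∀ X → agree X X ≡ true
agree-refl true = refl
agree-refl false = refl

module Potential (k : ℕ) where

  -- cost X p b: the number of arcs charged to value b standing at position
  -- p, at a vertex of parity X (true = even; even vertices exchange
  -- position 0 with the small positions, those below k).  A value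
  -- b ≠ 0 in position 0 costs 1 if its home is reachable now and 2
  -- otherwise; a misplaced value at a position p ≠ 0 costs 2 if its home has
  -- the class of p and 1 otherwise.
  cost : Bool → ℕ → ℕ → ℕ
  cost X zero zero = 0
  cost X zero (suc b) = if agree (suc b <ᵇ k) X then 1 else 2
  cost X (suc a) b =
    if b ≡ᵇ suc a then 0 else (if b ≡ᵇ 0 then 0 else (if agree (b <ᵇ k) (suc a <ᵇ k) then 2 else 1))

  cost-home : ∀ X a → cost X a a ≡ 0
  cost-home X zero = refl
  cost-home X (suc a) rewrite ≡ᵇ-refl a = refl

  cost-misplaced : ∀ X a b → b ≢ suc a → b ≢ 0 → (b <ᵇ k) ≡ (suc a <ᵇ k) → cost X (suc a) b ≡ 2
  cost-misplaced X a zero _ b≢0 _ = ⊥-elim (b≢0 refl)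
  cost-misplaced X a (suc b) b≢a+1 _ same with b ≡ᵇ a in eq
  ... | true = ⊥-elim (b≢a+1 (cong suc (≡ᵇ-true b a eq)))
  ... | false rewrite same = cong (λ z → if z then 2 else 1) (agree-refl (suc a <ᵇ k))

  -- The value b leaves the exchanged position a+1 (whose class is X) for 0.
  cost-leave : ∀ a b X → (suc a <ᵇ k) ≡ X → cost X (suc a) b ≤ cost (not X) 0 b
  cost-leave a zero X _ = z≤n
  cost-leave a (suc b) X class with b ≡ᵇ a
  ... | true = z≤n
  ... | false rewrite class = ordered (suc b <ᵇ k) X
    where
    ordered : ∀ S X → (if agree S X then 2 else 1) ≤ (if agree S (not X) then 1 else 2)
    ordered true true = ≤-refl
    ordered true false = ≤-refl
    ordered false true = ≤-refl
    ordered false false = ≤-refl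

  -- The value b leaves position 0 for the exchanged position a+1; this is
  -- the only move that can lower the potential, and only if b ≠ 0.
  cost-enter : ∀ a b X → (suc a <ᵇ k) ≡ X → cost X 0 b ≤ cost (not X) (suc a) b + ind (not (b ≡ᵇ 0))
  cost-enter a zero X _ = z≤n
  cost-enter a (suc b) X class with agree (suc b <ᵇ k) X in reachable
  ... | true = m≤n+m 1 _
  ... | false with b ≡ᵇ a in eq
  ...   | true = ⊥-elim (true≢false (begin
      true                    ≡⟨ sym (agree-refl X) ⟩
      agree X X               ≡⟨ cong (λ z → agree z X) (sym class) ⟩
      agree (suc a <ᵇ k) X    ≡⟨ cong (λ z → agree (suc z <ᵇ k) X) (sym (≡ᵇ-true b a eq)) ⟩
      agree (suc b <ᵇ k) X    ≡⟨ reachable ⟩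
      false                   ∎))
    where
    open ≡-Reasoning
    true≢false : true ≢ false
    true≢false ()
  ...   | false rewrite class | reachable = ≤-refl

  Φ : ∀ {n} → Bool → (Fin n → ℕ) → ℕ
  Φ X g = sum λ p → cost X (toℕ p) (g p)

  Φ-home : ∀ {n} X (g : Fin n → ℕ) → (∀ p → g p ≡ toℕ p) → Φ X g ≡ 0
  Φ-home X g g≗toℕ = sum-zero _ (λ p → trans (cong (cost X (toℕ p)) (g≗toℕ p)) (cost-home X (toℕ p)))

  Φ-exchange : ∀ {n} (X : Bool) (g g' : Fin n → ℕ) (i j : Fin n) (t : ℕ) →
    toℕ i ≡ 0 → toℕ j ≡ suc t → (suc t <ᵇ k) ≡ X → (∀ x → g' x ≡ g (PC.transpose i j x)) →
    Φ X g ≤ Φ (not X) g' + ind (not (g i ≡ᵇ 0))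
  Φ-exchange {n} X g g' i j t i≡0 j≡t+1 class g'≗gτ = begin
      Φ X g
    ≡⟨ ∑-permute _ (Perm.transpose i j) ⟩
      sum (λ p → cost X (toℕ (τ p)) (g (τ p)))
    ≤⟨ sum-mono pointwise ⟩
      sum (λ p → cost (not X) (toℕ p) (g' p) + (if toℕ p ≡ᵇ suc t then c else 0))
    ≡⟨ ∑-distrib-+ (λ p → cost (not X) (toℕ p) (g' p)) (λ p → if toℕ p ≡ᵇ suc t then c else 0) ⟩
      Φ (not X) g' + sum (λ (p : Fin n) → if toℕ p ≡ᵇ suc t then c else 0)
    ≡⟨ cong (Φ (not X) g' +_) (sum-single (suc t) j j≡t+1 (λ _ → c)) ⟩
      Φ (not X) g' + c
    ∎
    where
    open ≤-Reasoning
    τ : Fin n → Fin n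
    τ = PC.transpose i j
    c : ℕ
    c = ind (not (g i ≡ᵇ 0))
    pointwise : ∀ p → cost X (toℕ (τ p)) (g (τ p))
                      ≤ cost (not X) (toℕ p) (g' p) + (if toℕ p ≡ᵇ suc t then c else 0)
    pointwise p with fin-dec p i | fin-dec p j
    ... | inj₁ refl | _ rewrite transpose-left p j | j≡t+1 | i≡0 | g'≗gτ p | transpose-left p j =
      ≤-trans (cost-leave t (g j) X class) (m≤m+n _ _)
    ... | inj₂ _ | inj₁ refl
      rewrite transpose-right i p | j≡t+1 | ≡ᵇ-refl t | g'≗gτ p | transpose-right i p | i≡0 =
      cost-enter t (g i) X class
    ... | inj₂ p≢i | inj₂ p≢j
      rewrite transpose-other i j p p≢i p≢j | g'≗gτ p | transpose-other i j p p≢i p≢j =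
      untouched (toℕ p) refl
      where
      untouched : ∀ q → toℕ p ≡ q → cost X q (g p) ≤ cost (not X) q (g p) + (if q ≡ᵇ suc t then c else 0)
      untouched zero p≡0 = ⊥-elim (p≢i (toℕ-injective (trans p≡0 (sym i≡0))))
      untouched (suc q) _ = m≤m+n _ _

module WalkBound (n : ℕ) where
  open Potential (kOf n)

  Φᵛ : Permutation′ n → ℕ
  Φᵛ π = Φ (evenPerm n π) (values π)

  Φᵛ-arc : ∀ π σ → Arc n π σ →
    Σ (Fin n) λ i → (toℕ i ≡ 0) × (Φᵛ π ≤ Φᵛ σ + ind (not (values π i ≡ᵇ 0)))
  Φᵛ-arc π σ a = i , i≡0 ,
    subst (λ X → Φᵛ π ≤ Φ X (values σ) + ind (not (values π i ≡ᵇ 0))) (sym (parity-arc n π σ a))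
    (Φ-exchange (evenPerm n π) (values π) (values σ) i j t i≡0 j≡t+1 class (λ x → cong toℕ (σ≗πτ x)))
    where open Exchange (arc-exchange n π σ a)

  walk-potential : ∀ {π m} → Walk n π Perm.id m → Φᵛ π ≤ m
  walk-potential {π} (stop π≗id) = ≤-reflexive (Φ-home _ (values π) (λ p → cong toℕ (π≗id p)))
  walk-potential {π} {suc m} (step {σ = σ} a w) with Φᵛ-arc π σ a
  ... | i , _ , bound = ≤-trans bound (≤-trans (+-mono-≤ (walk-potential w) (ind≤1 _)) (≤-reflexive (+-comm m 1)))
    where
    ind≤1 : ∀ b → ind b ≤ 1
    ind≤1 true = ≤-refl
    ind≤1 false = z≤n

  -- If π has the value 0 in position 0 its first arc is free, so the walk
  -- is one longer than Φᵛ π.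
  walk-potential-fixed : ∀ {π m} → (∀ i → toℕ i ≡ 0 → values π i ≡ 0) →
    Walk n π Perm.id (suc m) → Φᵛ π ≤ m
  walk-potential-fixed {π} fixed (step {σ = σ} a w) with Φᵛ-arc π σ a
  ... | i , i≡0 , bound rewrite fixed i i≡0 =
    ≤-trans bound (≤-trans (≤-reflexive (+-identityʳ _)) (walk-potential w))

clamp : ∀ {N} → ℕ → Fin (suc N)
clamp zero = zero
clamp {zero} (suc m) = zero
clamp {suc N} (suc m) = suc (clamp m)

toℕ-clamp : ∀ {N} m → m ≤ N → toℕ (clamp {N} m) ≡ m
toℕ-clamp zero _ = refl
toℕ-clamp {suc N} (suc m) (s≤s m≤N) = cong suc (toℕ-clamp m m≤N)

module Rotation (N : ℕ) where

  swapAt : ℕ → Fin (suc N) → Fin (suc N)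
  swapAt c = PC.transpose (clamp c) (clamp (suc c))

  -- rotation a m sends position p to p+1 for a ≤ p < a+m, and a+m to a;
  -- it is the product of the m adjacent transpositions (a+m-1 a+m) … (a a+1).
  rotation : ℕ → ℕ → Permutation′ (suc N)
  rotation a zero = Perm.id
  rotation a (suc m) = Perm.transpose (clamp (a + m)) (clamp (suc (a + m))) ∘ₚ rotation a m

  swapAt-left : ∀ c p → suc c ≤ N → toℕ p ≡ c → toℕ (swapAt c p) ≡ suc c
  swapAt-left c p c<N p≡c
    with toℕ-injective {i = p} {j = clamp c} (trans p≡c (sym (toℕ-clamp c (<⇒≤ c<N))))
  ... | refl = trans (cong toℕ (transpose-left (clamp c) (clamp (suc c)))) (toℕ-clamp (suc c) c<N)

  swapAt-right : ∀ c p → suc c ≤ N → toℕ p ≡ suc c → toℕ (swapAt c p) ≡ c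
  swapAt-right c p c<N p≡c+1
    with toℕ-injective {i = p} {j = clamp (suc c)} (trans p≡c+1 (sym (toℕ-clamp (suc c) c<N)))
  ... | refl = trans (cong toℕ (transpose-right (clamp c) (clamp (suc c)))) (toℕ-clamp c (<⇒≤ c<N))

  swapAt-other : ∀ c p → suc c ≤ N → toℕ p ≢ c → toℕ p ≢ suc c → swapAt c p ≡ p
  swapAt-other c p c<N p≢c p≢c+1 = transpose-other (clamp c) (clamp (suc c)) p
    (λ e → p≢c (trans (cong toℕ e) (toℕ-clamp c (<⇒≤ c<N))))
    (λ e → p≢c+1 (trans (cong toℕ e) (toℕ-clamp (suc c) c<N)))

  last-in-range : ∀ a m → a + suc m ≤ N → suc (a + m) ≤ N
  last-in-range a m = subst (_≤ N) (+-suc a m)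

  rotation-outside : ∀ a m p → a + m ≤ N → (toℕ p < a ⊎ a + m < toℕ p) → rotation a m ⟨$⟩ʳ p ≡ p
  rotation-outside a zero p _ _ = refl
  rotation-outside a (suc m) p a+m+1≤N outside =
    trans (cong (rotation a m ⟨$⟩ʳ_) (swapAt-other (a + m) p bound (≢-last outside) (≢-next outside)))
          (rotation-outside a m p (<⇒≤ bound) (shrink outside))
    where
    bound : suc (a + m) ≤ N
    bound = last-in-range a m a+m+1≤N
    ≢-last : (toℕ p < a ⊎ a + suc m < toℕ p) → toℕ p ≢ a + m
    ≢-last (inj₁ p<a) e = <⇒≢ (<-≤-trans p<a (m≤m+n a m)) e
    ≢-last (inj₂ a+m+1<p) e = <⇒≢ (≤-trans (s≤s (n≤1+n _)) (subst (_< toℕ p) (+-suc a m) a+m+1<p)) (sym e)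
    ≢-next : (toℕ p < a ⊎ a + suc m < toℕ p) → toℕ p ≢ suc (a + m)
    ≢-next (inj₁ p<a) e = <⇒≢ (<-≤-trans p<a (≤-trans (m≤m+n a m) (n≤1+n _))) e
    ≢-next (inj₂ a+m+1<p) e = <⇒≢ (subst (_< toℕ p) (+-suc a m) a+m+1<p) (sym e)
    shrink : (toℕ p < a ⊎ a + suc m < toℕ p) → toℕ p < a ⊎ a + m < toℕ p
    shrink (inj₁ p<a) = inj₁ p<a
    shrink (inj₂ a+m+1<p) = inj₂ (<-trans (n<1+n _) (subst (_< toℕ p) (+-suc a m) a+m+1<p))

  rotation-last : ∀ a m p → a + m ≤ N → toℕ p ≡ a + m → toℕ (rotation a m ⟨$⟩ʳ p) ≡ a
  rotation-last a zero p _ p≡a+0 = trans p≡a+0 (+-identityʳ a)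
  rotation-last a (suc m) p a+m+1≤N p≡a+m+1 =
    rotation-last a m (swapAt (a + m) p) (<⇒≤ bound) (swapAt-right (a + m) p bound (trans p≡a+m+1 (+-suc a m)))
    where
    bound : suc (a + m) ≤ N
    bound = last-in-range a m a+m+1≤N

  rotation-shift : ∀ a m p → a + m ≤ N → a ≤ toℕ p → toℕ p < a + m →
    toℕ (rotation a m ⟨$⟩ʳ p) ≡ suc (toℕ p)
  rotation-shift a zero p _ a≤p p<a+0 = ⊥-elim (<⇒≱ p<a+0 (subst (_≤ toℕ p) (sym (+-identityʳ a)) a≤p))
  rotation-shift a (suc m) p a+m+1≤N a≤p p<a+m+1 with toℕ p ≟ a + m
  ... | yes p≡a+m =
    trans (cong toℕ (rotation-outside a m (swapAt (a + m) p) (<⇒≤ bound) (inj₂ (≤-reflexive (sym moved)))))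
          (trans moved (cong suc (sym p≡a+m)))
    where
    bound : suc (a + m) ≤ N
    bound = last-in-range a m a+m+1≤N
    moved : toℕ (swapAt (a + m) p) ≡ suc (a + m)
    moved = swapAt-left (a + m) p bound p≡a+m
  ... | no p≢a+m = trans (cong (λ q → toℕ (rotation a m ⟨$⟩ʳ q)) fixed)
                         (rotation-shift a m p (<⇒≤ bound) a≤p p<a+m)
    where
    bound : suc (a + m) ≤ N
    bound = last-in-range a m a+m+1≤N
    p<a+m : toℕ p < a + m
    p<a+m = ≤∧≢⇒< (≤-pred (subst (toℕ p <_) (+-suc a m) p<a+m+1)) p≢a+m
    fixed : swapAt (a + m) p ≡ p
    fixed = swapAt-other (a + m) p bound p≢a+m (<⇒≢ (<-trans p<a+m (n<1+n _)))

  rotation-block : ∀ a m p → a + suc m ≤ N → a ≤ toℕ p → toℕ p ≤ a + suc m →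
    let q = toℕ (rotation a (suc m) ⟨$⟩ʳ p) in (a ≤ q) × (q ≤ a + suc m) × (q ≢ toℕ p)
  rotation-block a m p a+m+1≤N a≤p p≤a+m+1 with toℕ p ≟ a + suc m
  ... | yes p≡last rewrite rotation-last a (suc m) p a+m+1≤N p≡last | p≡last =
    ≤-refl , m≤m+n a (suc m) , <⇒≢ (m<m+n a z<s)
  ... | no p≢last rewrite rotation-shift a (suc m) p a+m+1≤N a≤p (≤∧≢⇒< p≤a+m+1 p≢last) =
    ≤-trans a≤p (n≤1+n _) , ≤∧≢⇒< p≤a+m+1 p≢last , 1+n≢n

  rotation-parity : ∀ (g : Fin (suc N) → ℕ) → Injective _≡_ _≡_ g → ∀ a m → a + m ≤ N →
    isEven (inv (λ p → g (rotation a m ⟨$⟩ʳ p))) ≡ flips m (isEven (inv g))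
  rotation-parity g g-inj a zero _ = refl
  rotation-parity g g-inj a (suc m) a+m+1≤N =
    trans (inv-adjacent-flip (λ p → g (rotation a m ⟨$⟩ʳ p)) (clamp (a + m)) (clamp (suc (a + m)))
             (trans (toℕ-clamp (suc (a + m)) bound) (cong suc (sym (toℕ-clamp (a + m) (<⇒≤ bound)))))
             (λ e → distinct (perm-injective (rotation a m) (g-inj e))))
          (cong not (rotation-parity g g-inj a m (<⇒≤ bound)))
    where
    bound : suc (a + m) ≤ N
    bound = last-in-range a m a+m+1≤N
    distinct : clamp (a + m) ≢ clamp (suc (a + m))
    distinct e = 1+n≢n (sym (trans (sym (toℕ-clamp (a + m) (<⇒≤ bound)))
                                   (trans (cong toℕ e) (toℕ-clamp (suc (a + m)) bound))))

evenPerm-id : ∀ n → evenPerm n Perm.id ≡ true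
evenPerm-id n = trans (parity≡ n Perm.id)
  (cong isEven (sum-zero {n} _ λ x → sum-zero {n} _ λ y → cong ind (asym (toℕ x) (toℕ y))))
  where
  asym : ∀ a b → ((a <ᵇ b) ∧ (b <ᵇ a)) ≡ false
  asym zero zero = refl
  asym zero (suc b) = refl
  asym (suc a) zero = refl
  asym (suc a) (suc b) = asym a b

module FarVertices (N : ℕ) where
  open Rotation N
  open Potential (kOf (suc N))
  open WalkBound (suc N)

  small : ℕ → Bool
  small p = p <ᵇ kOf (suc N)

  record ClassDerangement (lo : ℕ) (u : Permutation′ (suc N)) : Set where
    field
      fixed : ∀ p → toℕ p < lo → u ⟨$⟩ʳ p ≡ p
      stays-above : ∀ p → lo ≤ toℕ p → lo ≤ values u p
      moved : ∀ p → lo ≤ toℕ p → values u p ≢ toℕ p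
      same-class : ∀ p → lo ≤ toℕ p → small (values u p) ≡ small (toℕ p)

  id-derangement : ClassDerangement (suc N) Perm.id
  id-derangement = record
    { fixed = λ _ _ → refl
    ; stays-above = λ p N<p → ⊥-elim (<⇒≱ (toℕ<n p) N<p)
    ; moved = λ p N<p → ⊥-elim (<⇒≱ (toℕ<n p) N<p)
    ; same-class = λ p N<p → ⊥-elim (<⇒≱ (toℕ<n p) N<p) }

  OneClass : ℕ → ℕ → Set
  OneClass a b = (b < kOf (suc N)) ⊎ (kOf (suc N) ≤ a)

  one-class : ∀ {a b x y} → OneClass a b → a ≤ x → x ≤ b → a ≤ y → y ≤ b → small x ≡ small y
  one-class (inj₁ b<k) a≤x x≤b a≤y y≤b =
    trans (<ᵇ-true (≤-<-trans x≤b b<k)) (sym (<ᵇ-true (≤-<-trans y≤b b<k)))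
  one-class (inj₂ k≤a) a≤x x≤b a≤y y≤b =
    trans (<ᵇ-false (≤-trans k≤a a≤x)) (sym (<ᵇ-false (≤-trans k≤a a≤y)))

  add-block : ∀ a m u → a + suc m ≤ N → OneClass a (a + suc m) →
    ClassDerangement (suc (a + suc m)) u → ClassDerangement a (rotation a (suc m) ∘ₚ u)
  add-block a m u a+m+1≤N one u-der = record
    { fixed = fixed′
    ; stays-above = λ p a≤p → proj₁ (image p a≤p)
    ; moved = λ p a≤p → proj₁ (proj₂ (image p a≤p))
    ; same-class = λ p a≤p → proj₂ (proj₂ (image p a≤p)) }
    where
    open ClassDerangement u-der
    ρ : Permutation′ (suc N)
    ρ = rotation a (suc m)
    fixed′ : ∀ p → toℕ p < a → u ⟨$⟩ʳ (ρ ⟨$⟩ʳ p) ≡ p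
    fixed′ p p<a rewrite rotation-outside a (suc m) p a+m+1≤N (inj₁ p<a) =
      fixed p (<-trans p<a (s≤s (m≤m+n a (suc m))))
    image : ∀ p → a ≤ toℕ p → let q = toℕ (u ⟨$⟩ʳ (ρ ⟨$⟩ʳ p)) in
      (a ≤ q) × (q ≢ toℕ p) × (small q ≡ small (toℕ p))
    image p a≤p with toℕ p ≤? a + suc m
    ... | yes p≤b with rotation-block a m p a+m+1≤N a≤p p≤b
    ...   | a≤q , q≤b , q≢p rewrite fixed (ρ ⟨$⟩ʳ p) (s≤s q≤b) =
      a≤q , q≢p , one-class one a≤q q≤b a≤p p≤b
    image p a≤p | no p≰b rewrite rotation-outside a (suc m) p a+m+1≤N (inj₂ (≰⇒> p≰b)) =
      ≤-trans (≤-trans (m≤m+n a (suc m)) (n≤1+n _)) (stays-above p (≰⇒> p≰b))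
      , moved p (≰⇒> p≰b) , same-class p (≰⇒> p≰b)

  add-block-parity : ∀ a m u → a + m ≤ N →
    evenPerm (suc N) (rotation a m ∘ₚ u) ≡ flips m (evenPerm (suc N) u)
  add-block-parity a m u a+m≤N =
    trans (parity≡ (suc N) (rotation a m ∘ₚ u))
      (trans (rotation-parity (values u) (values-injective u) a m a+m≤N)
        (cong (flips m) (sym (parity≡ (suc N) u))))

  -- Each position p ≥ 1 of a class derangement from 1 costs 2.
  Φᵛ-derangement : ∀ u → ClassDerangement 1 u → Φᵛ u ≡ N * 2
  Φᵛ-derangement u u-der rewrite ClassDerangement.fixed u-der zero (s≤s z≤n) =
    trans (sum-cong-≗ costs-two) (sum-const {N} 2)
    where
    open ClassDerangement u-der
    costs-two : ∀ (p : Fin N) → cost (evenPerm (suc N) u) (suc (toℕ p)) (values u (suc p)) ≡ 2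
    costs-two p = cost-misplaced (evenPerm (suc N) u) (toℕ p) _ (moved (suc p) (s≤s z≤n))
      (λ e → <⇒≢ (stays-above (suc p) (s≤s z≤n)) (sym e)) (same-class (suc p) (s≤s z≤n))

  walk-lower-bound : 1 ≤ N → ∀ u → ClassDerangement 1 u → ∀ m → Walk (suc N) u Perm.id m → suc (N + N) ≤ m
  walk-lower-bound 1≤N u u-der zero (stop u≗id) =
    ⊥-elim (moved p (≤-reflexive (sym (toℕ-clamp 1 1≤N))) (cong toℕ (u≗id p)))
    where
    open ClassDerangement u-der
    p : Fin (suc N)
    p = clamp 1
  walk-lower-bound 1≤N u u-der (suc m) w = s≤s (begin
      N + N        ≡⟨ cong (N +_) (sym (+-identityʳ N)) ⟩
      N + (N + 0)  ≡⟨ *-comm 2 N ⟩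
      N * 2        ≡⟨ sym (Φᵛ-derangement u u-der) ⟩
      Φᵛ u         ≤⟨ walk-potential-fixed fixed0 w ⟩
      m            ∎)
    where
    open ≤-Reasoning
    open ClassDerangement u-der
    fixed0 : ∀ i → toℕ i ≡ 0 → values u i ≡ 0
    fixed0 i i≡0 with toℕ-injective {i = i} {j = zero} i≡0
    ... | refl = cong toℕ (fixed zero (s≤s z≤n))

  -- If moreover u is even, the length is even, hence at least 2N + 2.
  walk-lower-bound-even : 1 ≤ N → ∀ u → ClassDerangement 1 u → evenPerm (suc N) u ≡ true →
    ∀ m → Walk (suc N) u Perm.id m → suc (suc (N + N)) ≤ m
  walk-lower-bound-even 1≤N u u-der even m w with m≤n⇒m<n∨m≡n (walk-lower-bound 1≤N u u-der m w)
  ... | inj₁ longer = longer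
  ... | inj₂ refl = ⊥-elim (true≢false (begin
      true                                     ≡⟨ sym even ⟩
      evenPerm (suc N) u                       ≡⟨ parity-walk w ⟩
      flips (suc (N + N)) (evenPerm (suc N) Perm.id) ≡⟨ cong (flips (suc (N + N))) (evenPerm-id (suc N)) ⟩
      not (flips (N + N) true)                 ≡⟨ cong not (flips-double N true) ⟩
      false                                    ∎))
    where
    open ≡-Reasoning
    true≢false : true ≢ false
    true≢false ()

  top-block : ∀ a m → a + suc m ≡ N → kOf (suc N) ≤ a →
    ClassDerangement a (rotation a (suc m) ∘ₚ Perm.id)
  top-block a m top k≤a = add-block a m Perm.id (≤-reflexive top) (inj₂ k≤a)
    (subst (λ lo → ClassDerangement lo Perm.id) (cong suc (sym top)) id-derangement)

  top-block-parity : ∀ a m → a + m ≤ N → evenPerm (suc N) (rotation a m ∘ₚ Perm.id) ≡ flips m true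
  top-block-parity a m a+m≤N =
    trans (add-block-parity a m Perm.id a+m≤N) (cong (flips m) (evenPerm-id (suc N)))

FarVertex : ℕ → ℕ → Set
FarVertex n d = Σ (Permutation′ n) λ u → ∀ m → Walk n u Perm.id m → d ≤ m

kOf-odd : ∀ r → kOf (suc (r + r)) ≡ suc r
kOf-odd r = trans (cong (_+ 1) (⌊odd/2⌋ r)) (+-comm r 1)
  where
  ⌊odd/2⌋ : ∀ r → ⌊ suc (r + r) /2⌋ ≡ r
  ⌊odd/2⌋ zero = refl
  ⌊odd/2⌋ (suc r) rewrite +-suc r r = cong suc (⌊odd/2⌋ r)

kOf-even : ∀ r → kOf (suc (suc (r + r))) ≡ suc (suc r)
kOf-even r = trans (cong (λ h → suc h + 1) (sym (n≡⌊n+n/2⌋ r))) (cong suc (+-comm r 1))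

-- n = 2r + 1 with r = s + 2, so k = r + 1: rotate the small block [1, r]
-- and the large block [r + 1, 2r]; both are r-cycles, so u is even.
module OddOrder (s : ℕ) where
  r N : ℕ
  r = 2 + s
  N = r + r
  open Rotation N
  open FarVertices N

  k≡r+1 : kOf (suc N) ≡ suc r
  k≡r+1 = kOf-odd r

  top : suc r + suc s ≡ N
  top = sym (+-suc r (suc s))

  high u : Permutation′ (suc N)
  high = rotation (suc r) (suc s) ∘ₚ Perm.id
  u = rotation 1 (suc s) ∘ₚ high

  u-derangement : ClassDerangement 1 u
  u-derangement = add-block 1 s high (m≤m+n r r) (inj₁ (subst (r <_) (sym k≡r+1) (n<1+n r)))
    (top-block (suc r) s top (≤-reflexive k≡r+1))

  u-even : evenPerm (suc N) u ≡ true
  u-even = begin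
      evenPerm (suc N) u
    ≡⟨ add-block-parity 1 (suc s) high (m≤m+n r r) ⟩
      flips (suc s) (evenPerm (suc N) high)
    ≡⟨ cong (flips (suc s)) (top-block-parity (suc r) (suc s) (≤-reflexive top)) ⟩
      flips (suc s) (flips (suc s) true)
    ≡⟨ flips-cancel (suc s) true ⟩
      true
    ∎
    where open ≡-Reasoning

  far : FarVertex (suc N) (suc (suc (N + N)))
  far = u , walk-lower-bound-even (s≤s z≤n) u u-derangement u-even

-- n = 2r + 2 with r = s + 2, so k = r + 2: rotate the small block
-- [1, r + 1] and the large block [r + 2, 2r + 1].
module EvenOrder (s : ℕ) where
  r N : ℕ
  r = 2 + s
  N = suc (r + r)
  open Rotation N
  open FarVertices N

  k≡r+2 : kOf (suc N) ≡ suc (suc r)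
  k≡r+2 = kOf-even r

  top : suc (suc r) + suc s ≡ N
  top = cong suc (sym (+-suc r (suc s)))

  high u : Permutation′ (suc N)
  high = rotation (suc (suc r)) (suc s) ∘ₚ Perm.id
  u = rotation 1 (suc (suc s)) ∘ₚ high

  u-derangement : ClassDerangement 1 u
  u-derangement = add-block 1 (suc s) high (s≤s (m≤m+n r r)) (inj₁ (subst (suc r <_) (sym k≡r+2) (n<1+n (suc r))))
    (top-block (suc (suc r)) s top (≤-reflexive k≡r+2))

  far : FarVertex (suc N) (suc (N + N))
  far = u , walk-lower-bound (s≤s z≤n) u u-derangement

-- n = 2r + 2 with r = t + 3: splitting the small block into [1, 2] and
-- [3, r + 1] gives cycles of lengths 2, r - 1, r, so u is even.
module EvenOrderEven (t : ℕ) where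
  r N : ℕ
  r = 3 + t
  N = suc (r + r)
  open Rotation N
  open FarVertices N

  k≡r+2 : kOf (suc N) ≡ suc (suc r)
  k≡r+2 = kOf-even r

  small-block : ∀ {x} → x ≤ suc r → x < kOf (suc N)
  small-block {x} x≤r+1 = subst (x <_) (sym k≡r+2) (s≤s x≤r+1)

  top : suc (suc r) + suc (suc t) ≡ N
  top = cong suc (sym (+-suc r (suc (suc t))))

  middle≤N : 3 + suc t ≤ N
  middle≤N = s≤s (m≤m+n r r)

  high middle u : Permutation′ (suc N)
  high = rotation (suc (suc r)) (suc (suc t)) ∘ₚ Perm.id
  middle = rotation 3 (suc t) ∘ₚ high
  u = rotation 1 1 ∘ₚ middle

  u-derangement : ClassDerangement 1 u
  u-derangement =
    add-block 1 0 middle (≤-trans (s≤s (s≤s z≤n)) middle≤N) (inj₁ (small-block (s≤s (s≤s z≤n))))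
      (add-block 3 t high middle≤N (inj₁ (small-block ≤-refl))
        (top-block (suc (suc r)) (suc t) top (≤-reflexive k≡r+2)))

  u-even : evenPerm (suc N) u ≡ true
  u-even = begin
      evenPerm (suc N) u
    ≡⟨ add-block-parity 1 1 middle (≤-trans (s≤s (s≤s z≤n)) middle≤N) ⟩
      not (evenPerm (suc N) middle)
    ≡⟨ cong not (add-block-parity 3 (suc t) high middle≤N) ⟩
      not (flips (suc t) (evenPerm (suc N) high))
    ≡⟨ cong (λ b → not (flips (suc t) b)) (top-block-parity (suc (suc r)) (suc (suc t)) (≤-reflexive top)) ⟩
      not (flips (suc t) (not (flips (suc t) true)))
    ≡⟨ cong not (flips-not (suc t) (flips (suc t) true)) ⟩
      not (not (flips (suc t) (flips (suc t) true)))
    ≡⟨ cong (λ b → not (not b)) (flips-cancel (suc t) true) ⟩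
      true
    ∎
    where open ≡-Reasoning

  far : FarVertex (suc N) (suc (suc (N + N)))
  far = u , walk-lower-bound-even (s≤s z≤n) u u-derangement u-even

halves : ∀ N → Σ ℕ λ r → (N ≡ r + r) ⊎ (N ≡ suc (r + r))
halves zero = 0 , inj₁ refl
halves (suc N) with halves N
... | r , inj₁ N≡2r = r , inj₂ (cong suc N≡2r)
... | r , inj₂ N≡2r+1 = suc r , inj₁ (trans (cong suc N≡2r+1) (cong suc (sym (+-suc r r))))

weaken : ∀ {n d} → FarVertex n (suc d) → FarVertex n d
weaken (u , far) = u , λ m w → <⇒≤ (far m w)

far-vertices : ∀ N → 4 ≤ N →
  FarVertex (suc N) (suc (N + N)) × (N ≢ 5 → FarVertex (suc N) (suc (suc (N + N))))
far-vertices N 4≤N with halves N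
... | suc (suc s) , inj₁ refl = weaken (OddOrder.far s) , λ _ → OddOrder.far s
... | suc (suc zero) , inj₂ refl = EvenOrder.far 0 , λ N≢5 → ⊥-elim (N≢5 refl)
... | suc (suc (suc t)) , inj₂ refl = EvenOrder.far (suc t) , λ _ → EvenOrderEven.far t
... | zero , inj₁ refl with () ← 4≤N
... | suc zero , inj₁ refl with s≤s (s≤s ()) ← 4≤N
... | zero , inj₂ refl with s≤s () ← 4≤N
... | suc zero , inj₂ refl with s≤s (s≤s (s≤s ())) ← 4≤N

unreachable : ∀ {n d D} → FarVertex n d → D ≡ d →
  Σ (Permutation′ n) λ u → Σ (Permutation′ n) λ v → (m : ℕ) → m < D → ¬ Walk n u v m
unreachable (u , far) refl = u , Perm.id , λ m m<d w → <⇒≱ m<d (far m w)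

2n-1≡ : ∀ N → 2 * suc N ∸ 1 ≡ suc (N + N)
2n-1≡ N = trans (+-suc N (N + 0)) (cong (λ x → suc (N + x)) (+-identityʳ N))

theorem1 : (n : ℕ) → 5 ≤ n →
    (Σ (Permutation′ n) λ u → Σ (Permutation′ n) λ v →
       (m : ℕ) → m < 2 * n ∸ 1 → ¬ Walk n u v m)
    × (n ≢ 6 →
       Σ (Permutation′ n) λ u → Σ (Permutation′ n) λ v →
         (m : ℕ) → m < 2 * n → ¬ Walk n u v m)
theorem1 (suc N) (s≤s 4≤N) with far-vertices N 4≤N
... | far-2n-1 , far-2n =
    unreachable far-2n-1 (2n-1≡ N)
  , λ n≢6 → unreachable (far-2n (λ N≡5 → n≢6 (cong suc N≡5))) (cong suc (2n-1≡ N))
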